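{- Let $G$ be a graph with vertices $v_1\neq v_2$ and $k\ge1$. If there are $2k$ internally vertex-disjoint paths from $v_1$ to $v_2$ in $G$, then in every strong tree decomposition of $G$ of width at most $k$, the vertices $v_1$ and $v_2$ lie in the same bag.
   Context: A strong tree decomposition of $G=(V,E)$ is $(\{X_i\}_{i\in I},T=(I,F))$ where $\{X_i\}$ is a partition of $V$ and $T$ is a tree such that each edge has both ends in one bag or in bags of two adjacent tree nodes; its width is the maximum bag size. -}

module Defs where

open import Data.Nat using (ℕ; _≤_; _*_)
open import Data.Fin using (Fin; _≟_)
open import Data.List using (List; []; _∷_; length; filter)
open import Data.List.Membership.Propositional using (_∈_)
open import Data.List.Relation.Unary.Unique.Propositional using (Unique)
open import Data.Product using (Σ; ∃; _×_)
open import Data.Sum using (_⊎_)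
open import Data.List using (allFin)
open import Relation.Nullary using (¬_)
open import Relation.Binary.PropositionalEquality using (_≡_; _≢_)

record Graph (n : ℕ) : Set₁ where
  field
    Adj   : Fin n → Fin n → Set
    sym   : ∀ {u v} → Adj u v → Adj v u
    irrefl : ∀ {u} → ¬ Adj u u
open Graph public

data Walk {n : ℕ} (R : Fin n → Fin n → Set) : Fin n → Fin n → List (Fin n) → Set where
  single : ∀ {a} → Walk R a a (a ∷ [])
  step   : ∀ {a b c xs} → R a b → Walk R b c xs → Walk R a c (a ∷ xs)

IsPath : ∀ {n} → (Fin n → Fin n → Set) → Fin n → Fin n → List (Fin n) → Set
IsPath R a b xs = Walk R a b xs × Unique xs

record IsTree {m : ℕ} (T : Graph m) : Set where
  field
    connected : ∀ a b → ∃ λ xs → Walk (Adj T) a b xs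
    acyclic   : ∀ a b xs → IsPath (Adj T) a b xs → 3 ≤ length xs → ¬ Adj T b a

-- Strong tree decomposition of G: a tree T on nodes Fin m, and a map
-- bag : V → Fin m assigning each vertex its (unique) bag, i.e. the bags
-- X_i = bag⁻¹(i) form a partition of V (every bag nonempty).
record StrongTreeDecomposition {n : ℕ} (G : Graph n) : Set₁ where
  field
    m       : ℕ
    T       : Graph m
    isTree  : IsTree T
    bag     : Fin n → Fin m
    nonempty : ∀ i → ∃ λ v → bag v ≡ i
    edges   : ∀ {u v} → Adj G u v → bag u ≡ bag v ⊎ Adj T (bag u) (bag v)
open StrongTreeDecomposition public

bagSize : ∀ {n} {G : Graph n} → (D : StrongTreeDecomposition G) → Fin (m D) → ℕ
bagSize {n} D i = length (filter (λ v → bag D v ≟ i) (allFin n))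

WidthAtMost : ∀ {n} {G : Graph n} → StrongTreeDecomposition G → ℕ → Set
WidthAtMost D k = ∀ i → bagSize D i ≤ k

record DisjointPaths {n : ℕ} (G : Graph n) (v₁ v₂ : Fin n) (r : ℕ) : Set where
  field
    path     : Fin r → List (Fin n)
    isPath   : ∀ i → IsPath (Adj G) v₁ v₂ (path i)
    distinct : ∀ i j → i ≢ j → path i ≢ path j
    disjoint : ∀ i j → i ≢ j → ∀ x → x ∈ path i → x ∈ path j → x ≡ v₁ ⊎ x ≡ v₂

-- Suppose v₁ and v₂ lie in different bags A and B. Follow each of the 2k paths from v₁ until it
-- leaves A for the last time, along an edge x y; then bag(y) is a tree-neighbour of A, and the rest
-- of the path is a walk from bag(y) to B in the tree avoiding A. As the tree has no cycles, all these
-- neighbours coincide with one bag C. Each path then has a vertex other than v₁ in A ∪ C (x, or y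
-- when x = v₁), internal unless the path is the single edge v₁ v₂, which happens at most once. With
-- v₁ this gives 2k + 1 distinct vertices in two bags of size at most k.
module Submission where

open import Defs
open import Data.Nat using (ℕ; zero; suc; _≤_; _+_; _*_; s≤s; z≤n)
open import Data.Nat.Properties using (≤-trans; ≤-reflexive; +-suc; +-monoʳ-≤; +-mono-≤; +-identityʳ; n≤1+n; <-irrefl; module ≤-Reasoning)
open import Data.Fin using (Fin; _≟_)
import Data.Fin as Fin
open import Data.Fin.Properties using (injective⇒≤)
open import Data.List using (List; []; _∷_; _++_; _∷ʳ_; length; filter; allFin; map; reverse; lookup)
open import Data.List.Properties using (unfold-reverse)
open import Data.List.Membership.Propositional using (_∈_)
open import Data.List.Membership.Propositional.Properties using (∈-filter⁺; ∈-allFin; ∈-++⁺ʳ)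
open import Data.List.Relation.Binary.Subset.Propositional using (_⊆_)
open import Data.List.Relation.Binary.Subset.Propositional.Properties using (⊆-refl; ∷⁺ʳ; All-resp-⊇)
open import Data.List.Relation.Unary.Any using (here; there; index)
open import Data.List.Relation.Unary.Any.Properties using (lookup-index; reverse⁻)
open import Data.List.Relation.Unary.All as All using (All; []; _∷_)
open import Data.List.Relation.Unary.All.Properties using (¬Any⇒All¬; ++⁺; map⁺)
open import Data.List.Relation.Unary.AllPairs using ([]; _∷_)
open import Data.Vec.Functional using (Vector) renaming (_∷_ to _∷ᵛ_)
open import Data.Product using (∃; _×_; _,_; proj₁)
open import Data.Sum using (_⊎_; inj₁; inj₂)
open import Data.Empty using (⊥-elim)
open import Function using (_∘_)
open import Function.Definitions using (Injective)
open import Relation.Nullary using (¬_; yes; no; contradiction)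
open import Relation.Nullary.Decidable using (_⊎-dec_)
open import Relation.Unary using (Decidable; ∁)
open import Relation.Binary using (Symmetric)
open import Relation.Binary.PropositionalEquality as ≡ using (_≡_; _≢_; refl; trans; cong; subst; ≢-sym)

fresh-∷-injective : ∀ {A : Set} {m} {x : A} {f : Vector A m} →
                    Injective _≡_ _≡_ f → (∀ i → f i ≢ x) → Injective _≡_ _≡_ (x ∷ᵛ f)
fresh-∷-injective f-inj fresh {Fin.zero}  {Fin.zero}  _  = refl
fresh-∷-injective f-inj fresh {Fin.zero}  {Fin.suc j} eq = contradiction (≡.sym eq) (fresh j)
fresh-∷-injective f-inj fresh {Fin.suc i} {Fin.zero}  eq = contradiction eq (fresh i)
fresh-∷-injective f-inj fresh {Fin.suc i} {Fin.suc j} eq = cong Fin.suc (f-inj eq)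

injective⇒≤-count : ∀ {n m} {P : Fin n → Set} (P? : Decidable P) {f : Fin m → Fin n} →
                    Injective _≡_ _≡_ f → (∀ i → P (f i)) → m ≤ length (filter P? (allFin n))
injective⇒≤-count {n} P? {f} f-inj Pf = injective⇒≤ index-injective
  where
  member : ∀ i → f i ∈ filter P? (allFin n)
  member i = ∈-filter⁺ P? (∈-allFin (f i)) (Pf i)

  index-injective : Injective _≡_ _≡_ (index ∘ member)
  index-injective {i} {j} eq = f-inj (trans (lookup-index (member i))
                                      (trans (cong (lookup (filter P? (allFin n))) eq)
                                             (≡.sym (lookup-index (member j)))))

length-filter-⊎ : ∀ {A : Set} {P Q : A → Set} (P? : Decidable P) (Q? : Decidable Q) (xs : List A) →
                  length (filter (λ x → P? x ⊎-dec Q? x) xs) ≤ length (filter P? xs) + length (filter Q? xs)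
length-filter-⊎ P? Q? [] = z≤n
length-filter-⊎ P? Q? (x ∷ xs) with length-filter-⊎ P? Q? xs | P? x | Q? x
... | ih | yes _ | yes _ = s≤s (≤-trans ih (+-monoʳ-≤ _ (n≤1+n _)))
... | ih | yes _ | no _  = s≤s ih
... | ih | no _  | yes _ = ≤-trans (s≤s ih) (≤-reflexive (≡.sym (+-suc _ _)))
... | ih | no _  | no _  = ih

module _ {n} {R : Fin n → Fin n → Set} where
  open import Data.List.Membership.DecPropositional (_≟_ {n}) using (_∈?_)

  walk-start : ∀ {a b xs} → Walk R a b xs → a ∈ xs
  walk-start single     = here refl
  walk-start (step _ _) = here refl

  walk-end : ∀ {a b xs} → Walk R a b xs → b ∈ xs
  walk-end single     = here refl
  walk-end (step _ w) = there (walk-end w)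

  walk-head : ∀ {a b x xs} → Walk R a b (x ∷ xs) → x ≡ a
  walk-head single     = refl
  walk-head (step _ _) = refl

  distinct-ends⇒2≤length : ∀ {a b xs} → a ≢ b → Walk R a b xs → 2 ≤ length xs
  distinct-ends⇒2≤length a≢b single              = contradiction refl a≢b
  distinct-ends⇒2≤length a≢b (step _ single)     = s≤s (s≤s z≤n)
  distinct-ends⇒2≤length a≢b (step _ (step _ _)) = s≤s (s≤s z≤n)

  walk-snoc : ∀ {a b c xs} → Walk R a b xs → R b c → Walk R a c (xs ∷ʳ c)
  walk-snoc single     r = step r single
  walk-snoc (step s w) r = step s (walk-snoc w r)

  walk-reverse : Symmetric R → ∀ {a b xs} → Walk R a b xs → Walk R b a (reverse xs)
  walk-reverse R-sym single = single
  walk-reverse R-sym {a} (step {xs = xs} r w) =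
    subst (Walk R _ a) (≡.sym (unfold-reverse a xs)) (walk-snoc (walk-reverse R-sym w) (R-sym r))

  walk-join : ∀ {a b c d xs ys} → Walk R a b xs → R b c → Walk R c d ys → Walk R a d (xs ++ ys)
  walk-join single     r w = step r w
  walk-join (step s v) r w = step s (walk-join v r w)

  path-suffix : ∀ {a b c ys} → a ∈ ys → IsPath R b c ys → ∃ λ zs → IsPath R a c zs × zs ⊆ ys
  path-suffix (here refl) p@(single , _)   = _ , p , ⊆-refl
  path-suffix (here refl) p@(step _ _ , _) = _ , p , ⊆-refl
  path-suffix (there a∈ys) (step _ w , _ ∷ u) with path-suffix a∈ys (w , u)
  ... | zs , p , zs⊆ys = zs , p , there ∘ zs⊆ys

  walk⇒path : ∀ {a b xs} → Walk R a b xs → ∃ λ ys → IsPath R a b ys × ys ⊆ xs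
  walk⇒path single = _ , (single , [] ∷ []) , ⊆-refl
  walk⇒path (step {a = a} r w) with walk⇒path w
  ... | ys , (v , u) , ys⊆xs with a ∈? ys
  ...   | no a∉ys  = a ∷ ys , (step r v , ¬Any⇒All¬ ys a∉ys ∷ u) , ∷⁺ʳ a ys⊆xs
  ...   | yes a∈ys with path-suffix a∈ys (v , u)
  ...     | zs , p , zs⊆ys = zs , p , there ∘ ys⊆xs ∘ zs⊆ys

  record LastExit (S : Fin n → Set) (b : Fin n) (xs : List (Fin n)) : Set where
    field
      x y           : Fin n
      prefix suffix : List (Fin n)
      split         : xs ≡ prefix ++ x ∷ suffix
      x∈S           : S x
      edge          : R x y
      rest          : Walk R y b suffix
      rest-avoids   : All (∁ S) suffix

  exit-∷ : ∀ {S : Fin n → Set} {a b xs} → LastExit S b xs → LastExit S b (a ∷ xs)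
  exit-∷ {a = a} e = record { prefix = a ∷ prefix ; split = cong (a ∷_) split
                             ; x∈S = x∈S ; edge = edge ; rest = rest ; rest-avoids = rest-avoids }
    where open LastExit e

  avoids-or-exits : ∀ {S : Fin n → Set} → Decidable S → ∀ {a b xs} → ¬ S b →
                    Walk R a b xs → All (∁ S) xs ⊎ LastExit S b xs
  avoids-or-exits S? b∉S single = inj₁ (b∉S ∷ [])
  avoids-or-exits S? b∉S (step {a = a} r w) with avoids-or-exits S? b∉S w
  ... | inj₂ e = inj₂ (exit-∷ e)
  ... | inj₁ w-avoids with S? a
  ...   | no a∉S = inj₁ (a∉S ∷ w-avoids)
  ...   | yes a∈S = inj₂ (record { prefix = [] ; split = refl ; x∈S = a∈S ; edge = r
                                 ; rest = w ; rest-avoids = w-avoids })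

  last-exit : ∀ {S : Fin n → Set} → Decidable S → ∀ {a b xs} → ¬ S b →
              Walk R a b xs → S a → LastExit S b xs
  last-exit S? b∉S w a∈S with avoids-or-exits S? b∉S w
  ... | inj₁ avoids = contradiction a∈S (All.lookup avoids (walk-start w))
  ... | inj₂ e      = e

  path-is-edge : ∀ prefix {a b x y suffix} → IsPath R a b (prefix ++ x ∷ suffix) → x ≡ a →
                 Walk R y b suffix → y ≡ b → prefix ++ x ∷ suffix ≡ a ∷ b ∷ []
  path-is-edge []  _                      refl single     refl = refl
  path-is-edge []  (_ , _ ∷ (b∉ ∷ _))     refl (step _ w) refl = ⊥-elim (All.lookup b∉ (walk-end w) refl)
  path-is-edge (p ∷ prefix) (w , p∉ ∷ _)  refl _          _    =
    ⊥-elim (All.lookup p∉ (∈-++⁺ʳ prefix (here refl)) (walk-head w))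

Adj⁼ : ∀ {m} → Graph m → Fin m → Fin m → Set
Adj⁼ T x y = x ≡ y ⊎ Adj T x y

module _ {m} {T : Graph m} where
  Adj⁼-sym : Symmetric (Adj⁼ T)
  Adj⁼-sym (inj₁ x≡y) = inj₁ (≡.sym x≡y)
  Adj⁼-sym (inj₂ xy)  = inj₂ (sym T xy)

  path⁼⇒walk : ∀ {a b xs} → IsPath (Adj⁼ T) a b xs → Walk (Adj T) a b xs
  path⁼⇒walk (single , _)                   = single
  path⁼⇒walk (step (inj₁ refl) w , a∉ ∷ _)  = ⊥-elim (All.lookup a∉ (walk-start w) refl)
  path⁼⇒walk (step (inj₂ ab) w , _ ∷ u)     = step ab (path⁼⇒walk (w , u))

  tree-neighbour-unique : IsTree T → ∀ {a b c c′ xs ys} → Adj T a c → Adj T a c′ →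
                          Walk (Adj⁼ T) c b xs → All (_≢ a) xs →
                          Walk (Adj⁼ T) c′ b ys → All (_≢ a) ys → c ≡ c′
  tree-neighbour-unique tree {c = c} {c′} ac ac′ w w-avoids w′ w′-avoids with c ≟ c′
  ... | yes c≡c′ = c≡c′
  ... | no c≢c′ with walk⇒path (walk-join w (inj₁ refl) (walk-reverse Adj⁼-sym w′))
  ...   | ps , p@(_ , ps-unique) , ps⊆ =
    contradiction (sym T ac′)
      (IsTree.acyclic tree _ c′ (_ ∷ ps) cycle (s≤s (distinct-ends⇒2≤length c≢c′ p-walk)))
    where
    ps-avoids : All (_≢ _) ps
    ps-avoids = All-resp-⊇ ps⊆ (++⁺ w-avoids (All-resp-⊇ reverse⁻ w′-avoids))

    p-walk : Walk (Adj T) c c′ ps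
    p-walk = path⁼⇒walk p

    cycle : IsPath (Adj T) _ c′ (_ ∷ ps)
    cycle = step ac p-walk , All.map ≢-sym ps-avoids ∷ ps-unique

module _ {n} {G : Graph n} (D : StrongTreeDecomposition G) where
  open LastExit

  InBag : Fin (m D) → Fin n → Set
  InBag i v = bag D v ≡ i

  bag-walk : ∀ {u v xs} → Walk (Adj G) u v xs → Walk (Adj⁼ (T D)) (bag D u) (bag D v) (map (bag D) xs)
  bag-walk single     = single
  bag-walk (step r w) = step (edges D r) (bag-walk w)

  exit-bag-adjacent : ∀ {i v xs} (e : LastExit (InBag i) v xs) → Adj (T D) i (bag D (y e))
  exit-bag-adjacent e with edges D (edge e)
  ... | inj₁ same =
    contradiction (trans (≡.sym same) (x∈S e)) (All.lookup (rest-avoids e) (walk-start (rest e)))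
  ... | inj₂ adj  = subst (λ j → Adj (T D) j (bag D (y e))) (x∈S e) adj

  exit-bags-equal : ∀ {i v xs xs′} (e : LastExit (InBag i) v xs) (e′ : LastExit (InBag i) v xs′) →
                    bag D (y e) ≡ bag D (y e′)
  exit-bags-equal e e′ =
    tree-neighbour-unique (isTree D) (exit-bag-adjacent e) (exit-bag-adjacent e′)
      (bag-walk (rest e)) (map⁺ (rest-avoids e)) (bag-walk (rest e′)) (map⁺ (rest-avoids e′))

module _ {n} {G : Graph n} {v₁ v₂ : Fin n} {r} (P : DisjointPaths G v₁ v₂ r) where
  open DisjointPaths P

  record Representative (Q : Fin n → Set) (i : Fin r) : Set where
    field
      vertex           : Fin n
      on-path          : vertex ∈ path i
      ≢v₁              : vertex ≢ v₁
      internal-or-edge : vertex ≢ v₂ ⊎ path i ≡ v₁ ∷ v₂ ∷ []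
      satisfies        : Q vertex
  open Representative public

  representatives-injective : ∀ {Q} (ρ : ∀ i → Representative Q i) → Injective _≡_ _≡_ (vertex ∘ ρ)
  representatives-injective ρ {i} {j} same with i Fin.≟ j
  ... | yes i≡j = i≡j
  ... | no i≢j with disjoint i j i≢j _ (on-path (ρ i)) (subst (_∈ path j) (≡.sym same) (on-path (ρ j)))
  ...   | inj₁ ≡v₁ = contradiction ≡v₁ (≢v₁ (ρ i))
  ...   | inj₂ ≡v₂ with internal-or-edge (ρ i) | internal-or-edge (ρ j)
  ...     | inj₁ ≢v₂  | _         = contradiction ≡v₂ ≢v₂
  ...     | _         | inj₁ ≢v₂  = contradiction (trans (≡.sym same) ≡v₂) ≢v₂
  ...     | inj₂ edge-i | inj₂ edge-j = contradiction (trans edge-i (≡.sym edge-j)) (distinct i j i≢j)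

module _ {n} {G : Graph n} {v₁ v₂ : Fin n} {r} (P : DisjointPaths G v₁ v₂ (suc r))
         (D : StrongTreeDecomposition G) (separated : bag D v₁ ≢ bag D v₂) where
  open DisjointPaths P

  private
    exit : ∀ i → LastExit (InBag D (bag D v₁)) v₂ (path i)
    exit i = last-exit (λ v → bag D v ≟ bag D v₁) (separated ∘ ≡.sym) (proj₁ (isPath i)) refl

  neighbour-bag : Fin (m D)
  neighbour-bag = bag D (LastExit.y (exit Fin.zero))

  InTwoBags : Fin n → Set
  InTwoBags v = InBag D (bag D v₁) v ⊎ InBag D neighbour-bag v

  module _ (i : Fin (suc r)) where
    open LastExit (exit i)

    private
      x≢v₂ : x ≢ v₂
      x≢v₂ x≡v₂ = separated (trans (≡.sym x∈S) (cong (bag D) x≡v₂))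

      y≢v₁ : y ≢ v₁
      y≢v₁ y≡v₁ = All.lookup rest-avoids (walk-start rest) (cong (bag D) y≡v₁)

      y-internal-or-edge : x ≡ v₁ → y ≢ v₂ ⊎ path i ≡ v₁ ∷ v₂ ∷ []
      y-internal-or-edge x≡v₁ with y ≟ v₂
      ... | no y≢v₂  = inj₁ y≢v₂
      ... | yes y≡v₂ = inj₂ (trans split (path-is-edge prefix path-i x≡v₁ rest y≡v₂))
        where
        path-i : IsPath (Adj G) v₁ v₂ (prefix ++ x ∷ suffix)
        path-i = subst (IsPath (Adj G) v₁ v₂) split (isPath i)

    representative : Representative P InTwoBags i
    representative with x ≟ v₁
    ... | no x≢v₁  = record
      { vertex = x ; on-path = subst (x ∈_) (≡.sym split) (∈-++⁺ʳ prefix (here refl))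
      ; ≢v₁ = x≢v₁ ; internal-or-edge = inj₁ x≢v₂ ; satisfies = inj₁ x∈S }
    ... | yes x≡v₁ = record
      { vertex = y ; on-path = subst (y ∈_) (≡.sym split) (∈-++⁺ʳ prefix (there (walk-start rest)))
      ; ≢v₁ = y≢v₁ ; internal-or-edge = y-internal-or-edge x≡v₁
      ; satisfies = inj₂ (exit-bags-equal D (exit i) (exit Fin.zero)) }

  path-count≤bag-sizes : suc (suc r) ≤ bagSize D (bag D v₁) + bagSize D neighbour-bag
  path-count≤bag-sizes =
    ≤-trans (injective⇒≤-count (λ v → (bag D v ≟ bag D v₁) ⊎-dec (bag D v ≟ neighbour-bag))
               (fresh-∷-injective (representatives-injective P representative) (≢v₁ ∘ representative))
               λ { Fin.zero → inj₁ refl ; (Fin.suc i) → satisfies (representative i) })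
            (length-filter-⊎ _ _ (allFin n))

lemma3 : ∀ {n} (G : Graph n) (v₁ v₂ : Fin n) → v₁ ≢ v₂ → (k : ℕ) → 1 ≤ k →
         DisjointPaths G v₁ v₂ (2 * k) →
         (D : StrongTreeDecomposition G) → WidthAtMost D k →
         bag D v₁ ≡ bag D v₂
lemma3 _ _  _  _ zero    () _ _ _
lemma3 G v₁ v₂ _ (suc k) _  P D width with bag D v₁ ≟ bag D v₂
... | yes same     = same
... | no separated = ⊥-elim (<-irrefl refl (begin-strict
    2 * suc k
  <⟨ path-count≤bag-sizes P D separated ⟩
    bagSize D (bag D v₁) + bagSize D (neighbour-bag P D separated)
  ≤⟨ +-mono-≤ (width _) (width _) ⟩
    suc k + suc k
  ≡⟨ cong (suc k +_) (+-identityʳ (suc k)) ⟨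
    2 * suc k
  ∎))
  where open ≤-Reasoning
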